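{- Consider a singleton integer-splittable congestion game with players $N=\{1,\dots,n\}$, resources $E$, for each player $i$ a demand $d_i\in\mathbb{N}$ and a nonempty set $E_i\subseteq E$, and for each resource $e$ a non-decreasing, convex function $c_e:\mathbb{N}\to\mathbb{R}_+$. For $i\in N$ define $f_i:2^E\to\mathbb{N}$ by $f_i(U)=d_i$ if $U\cap E_i\neq\emptyset$ and $f_i(U)=0$ otherwise, and for $e\in E$ define $C_{i,e}(x;t)=c_e(x+t)\,x$. Then each $f_i$ is an integral polymatroid rank function, the strategy set of player $i$ equals $\mathbb{B}_{f_i}(d_i)$, each $C_{i,e}$ is regular, and player $i$'s cost equals $\sum_{e\in E}C_{i,e}(x_{i,e};x_{ -i,e})$; that is, the game is a polymatroid game.
   Context: In a singleton integer-splittable congestion game, a strategy of player $i$ is a vector $\mathbf{x}_i\in\mathbb{N}^E$ with $x_{i,e}=0$ for $e\notin E_i$ and $\sum_{e}x_{i,e}=d_i$; given a profile $\mathbf{x}=(\mathbf{x}_j)_{j\in N}$, with $x_{ -i,e}=\sum_{j\ne i}x_{j,e}$, player $i$'s cost is $\pi_i(\mathbf{x})=\sum_{e\in E}c_e(x_{i,e}+x_{ -i,e})x_{i,e}$. An integral polymatroid rank function is a submodular, monotone, normalized ($f(\emptyset)=0$) set function $f:2^E\to\mathbb{N}$. $\mathbb{B}_f(d)=\{\mathbf{x}\in\mathbb{N}^E: \sum_{e\in U}x_e\le f(U)\ \forall U\subseteq E,\ \sum_{e\in E}x_e=d\}$. For $C:\mathbb{N}\times\mathbb{N}\to\mathbb{R}$,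 $C^-(x;t)=C(x;t)-C(x-1;t)$ for $x\ge1$; $C$ is regular if $C^-(x;t)\le C^-(x;t+1)$ and $C^-(x;t+1)\le C^-(x+1;t)$ for all $x,t$ (where defined). A polymatroid game has players $N$, resources $E$, for each player $i$ an integral polymatroid rank function $f_i$ and demand $d_i\le f_i(E)$, strategy set $\mathbb{B}_{f_i}(d_i)$, and private cost $\sum_{e\in E}C_{i,e}(x_{i,e};x_{ -i,e})$ with each $C_{i,e}:\mathbb{N}\times\mathbb{N}\to\mathbb{R}_+$ regular. -}

module Defs where

open import Level using (Level; _⊔_)
open import Data.Nat as ℕ using (ℕ; zero; suc)
open import Data.Fin using (Fin; zero; suc; _≟_)
open import Data.Fin.Subset using (Subset; _∈_; _∉_; _⊆_; _∪_; _∩_; ⊥; ⊤; Nonempty)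
open import Data.Fin.Subset.Properties using (_∈?_; nonempty?)
open import Data.Bool using (if_then_else_)
open import Data.Product using (_×_)
open import Function using (_∘_)
open import Relation.Nullary using (does)
open import Relation.Binary.PropositionalEquality using (_≡_)
open import Relation.Binary.Structures using (IsTotalOrder)
open import Algebra.Bundles using (CommutativeRing)

-- Scalars: an ordered commutative ring (ℝ is an instance).  The stdlib
-- has no real numbers; the game's costs are taken in an arbitrary
-- (totally) ordered commutative ring.

record OrderedCommRing (c ℓ₁ ℓ₂ : Level) : Set (Level.suc (c ⊔ ℓ₁ ⊔ ℓ₂)) where
  field
    commutativeRing : CommutativeRing c ℓ₁
  open CommutativeRing commutativeRing public
  infix 4 _≤_
  field
    _≤_          : Carrier → Carrier → Set ℓ₂
    isTotalOrder : IsTotalOrder _≈_ _≤_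
    +-monoˡ-≤    : ∀ {x y} z → x ≤ y → x + z ≤ y + z
    *-nonneg     : ∀ {x y} → 0# ≤ x → 0# ≤ y → 0# ≤ x * y

Σℕ : ∀ {m} → (Fin m → ℕ) → ℕ
Σℕ {zero}  f = 0
Σℕ {suc m} f = f zero ℕ.+ Σℕ (f ∘ suc)

ΣOver : ∀ {m} → Subset m → (Fin m → ℕ) → ℕ
ΣOver U x = Σℕ (λ e → if does (e ∈? U) then x e else 0)

Normalized : ∀ {m} → (Subset m → ℕ) → Set
Normalized f = f ⊥ ≡ 0

Monotone : ∀ {m} → (Subset m → ℕ) → Set
Monotone f = ∀ U V → U ⊆ V → f U ℕ.≤ f V

Submodular : ∀ {m} → (Subset m → ℕ) → Set
Submodular f = ∀ U V → f (U ∪ V) ℕ.+ f (U ∩ V) ℕ.≤ f U ℕ.+ f V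

-- integral polymatroid rank function (values in ℕ by typing)
IsPolymatroidRank : ∀ {m} → (Subset m → ℕ) → Set
IsPolymatroidRank f = Submodular f × Monotone f × Normalized f

InB : ∀ {m} → (Subset m → ℕ) → ℕ → (Fin m → ℕ) → Set
InB f d x = (∀ U → ΣOver U x ℕ.≤ f U) × (Σℕ x ≡ d)

SingletonStrategy : ∀ {m} → Subset m → ℕ → (Fin m → ℕ) → Set
SingletonStrategy Ei d x = (∀ e → e ∉ Ei → x e ≡ 0) × (Σℕ x ≡ d)

fᵢ : ∀ {m} → Subset m → ℕ → Subset m → ℕ
fᵢ Ei d U = if does (nonempty? (U ∩ Ei)) then d else 0

Profile : ℕ → ℕ → Set
Profile n m = Fin n → Fin m → ℕ

x₋ : ∀ {n m} → Profile n m → Fin n → Fin m → ℕ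
x₋ x i e = Σℕ (λ j → if does (j ≟ i) then 0 else x j e)

module _ {c ℓ₁ ℓ₂} (R : OrderedCommRing c ℓ₁ ℓ₂) where
  open OrderedCommRing R using (Carrier; 0#; 1#; _+_; _*_; _-_; _≤_)

  ι : ℕ → Carrier
  ι zero    = 0#
  ι (suc k) = 1# + ι k

  ΣR : ∀ {m} → (Fin m → Carrier) → Carrier
  ΣR {zero}  f = 0#
  ΣR {suc m} f = f zero + ΣR (f ∘ suc)

  NonNeg : (ℕ → Carrier) → Set ℓ₂
  NonNeg g = ∀ k → 0# ≤ g k

  NonDecreasing : (ℕ → Carrier) → Set ℓ₂
  NonDecreasing g = ∀ k → g k ≤ g (suc k)

  Convex : (ℕ → Carrier) → Set ℓ₂
  Convex g = ∀ k → g (suc k) - g k ≤ g (suc (suc k)) - g (suc k)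

  -- C⁻(x;t) = C(x;t) - C(x-1;t)  (only used for x ≥ 1)
  C⁻ : (ℕ → ℕ → Carrier) → ℕ → ℕ → Carrier
  C⁻ C x t = C x t - C (x ℕ.∸ 1) t

  Regular : (ℕ → ℕ → Carrier) → Set ℓ₂
  Regular C = ∀ x t → 1 ℕ.≤ x →
    (C⁻ C x t ≤ C⁻ C x (suc t)) × (C⁻ C x (suc t) ≤ C⁻ C (suc x) t)

  NonNegC : (ℕ → ℕ → Carrier) → Set ℓ₂
  NonNegC C = ∀ x t → 0# ≤ C x t

  Cᵢₑ : (ℕ → Carrier) → ℕ → ℕ → Carrier
  Cᵢₑ ce x t = ce (x ℕ.+ t) * ι x

  π : ∀ {n m} → (Fin m → ℕ → Carrier) → Profile n m → Fin n → Carrier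
  π cst x i = ΣR (λ e → cst e (x i e ℕ.+ x₋ x i e) * ι (x i e))

module Submission where

open import Defs
open import Data.Nat using (ℕ; _≤_)
open import Data.Fin using (Fin)
open import Data.Fin.Subset using (Subset; Nonempty; ⊤)
open import Data.Product using (_×_)
open import Function.Bundles using (_⇔_)

open import Data.Nat using (zero; suc; z≤n)
open import Data.Fin using (zero; suc)
open import Data.Fin.Subset using (⊥; _∈_; _∉_; _∩_; _∪_; _⊆_; ⁅_⁆)
open import Data.Fin.Subset.Properties
  using (nonempty?; _∈?_; x∈p∩q⁺; x∈p∩q⁻; x∈p∪q⁻; p∩q⊆p; p∩q⊆q; ∉⊥; ∈⊤; x∈⁅x⁆; x∈⁅y⁆⇒x≡y)
open import Data.Bool using (if_then_else_)
open import Data.Product using (_,_; proj₁)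
open import Data.Sum using (_⊎_; inj₁; inj₂)
open import Function using (_∘_)
open import Function.Bundles using (mk⇔)
open import Relation.Nullary using (¬_; yes; no; does; contradiction)
open import Relation.Binary.PropositionalEquality using (_≡_; refl; subst)
open import Relation.Binary.Bundles using (TotalOrder)

-- It is monotone because meeting E is inherited by supersets, and
-- submodular by a general criterion: a monotone set function with
-- f(U ∪ V) ≤ f(U) or f(U ∪ V) ≤ f(V) is submodular (U ∪ V meets E only if U
-- or V does).  Its base polytope consists exactly of the singleton strategies:
-- a vector supported in E has load x(U) ≤ Σₑ xₑ = d, and 0 on sets missing E;
-- conversely x_e ≤ x({e}) ≤ f({e}) = 0 for every e ∉ E.
--
-- The
-- marginal cost of C(x;t) = c(x+t)·x is C⁻(x+1;t) = c(s+1) + x·Δc(s) with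
-- s = x+t and Δc the forward difference.  Raising t raises both c(s+1) and
-- Δc(s) (monotonicity, convexity); raising x instead adds Δc(s+1) ≥ 0.  These
-- are the two regularity inequalities.

module SingletonRank where
  open import Relation.Binary.PropositionalEquality using (sym)
  open import Data.Nat.Properties
    using (≤-refl; ≤-trans; ≤-reflexive; +-mono-≤; +-comm; m≤m+n; m≤n+m; n≤0⇒n≡0; module ≤-Reasoning)

  Meets : ∀ {m} → Subset m → Subset m → Set
  Meets U E = Nonempty (U ∩ E)

  meets-⊆ : ∀ {m} {U V E : Subset m} → U ⊆ V → Meets U E → Meets V E
  meets-⊆ {U = U} {E = E} U⊆V (e , e∈U∩E) with x∈p∩q⁻ U E e∈U∩E
  ... | e∈U , e∈E = e , x∈p∩q⁺ (U⊆V e∈U , e∈E)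

  meets-∪ : ∀ {m} (U V : Subset m) {E} → Meets (U ∪ V) E → Meets U E ⊎ Meets V E
  meets-∪ U V {E} (e , e∈U∪V∩E) with x∈p∩q⁻ (U ∪ V) E e∈U∪V∩E
  ... | e∈U∪V , e∈E with x∈p∪q⁻ U V e∈U∪V
  ...   | inj₁ e∈U = inj₁ (e , x∈p∩q⁺ (e∈U , e∈E))
  ...   | inj₂ e∈V = inj₂ (e , x∈p∩q⁺ (e∈V , e∈E))

  -- A monotone set function is submodular as soon as f(U ∪ V) ≤ f(U) or
  -- f(U ∪ V) ≤ f(V) for all U, V (then f(U ∩ V) is bounded by the other one).
  submodular-if-∪-bounded : ∀ {m} (f : Subset m → ℕ) → Monotone f
    → (∀ U V → f (U ∪ V) ≤ f U ⊎ f (U ∪ V) ≤ f V) → Submodular f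
  submodular-if-∪-bounded f mono ∪-bounded U V with ∪-bounded U V
  ... | inj₁ ∪≤U = +-mono-≤ ∪≤U (mono (U ∩ V) V (p∩q⊆q U V))
  ... | inj₂ ∪≤V = ≤-trans (+-mono-≤ ∪≤V (mono (U ∩ V) U (p∩q⊆p U V))) (≤-reflexive (+-comm (f V) (f U)))

  module _ {m} (E : Subset m) (d : ℕ) where

    fᵢ-meets : ∀ {U} → Meets U E → fᵢ E d U ≡ d
    fᵢ-meets {U} meets with nonempty? (U ∩ E)
    ... | yes _     = refl
    ... | no misses = contradiction meets misses

    fᵢ-misses : ∀ {U} → ¬ Meets U E → fᵢ E d U ≡ 0
    fᵢ-misses {U} misses with nonempty? (U ∩ E)
    ... | yes meets = contradiction meets misses
    ... | no _      = refl

    fᵢ-monotone : Monotone (fᵢ E d)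
    fᵢ-monotone U V U⊆V with nonempty? (U ∩ E)
    ... | yes meets = ≤-reflexive (sym (fᵢ-meets (meets-⊆ U⊆V meets)))
    ... | no _      = z≤n

    fᵢ-normalized : Normalized (fᵢ E d)
    fᵢ-normalized = fᵢ-misses λ (e , e∈⊥∩E) → ∉⊥ (proj₁ (x∈p∩q⁻ ⊥ E e∈⊥∩E))

    fᵢ-∪-bounded : ∀ U V → fᵢ E d (U ∪ V) ≤ fᵢ E d U ⊎ fᵢ E d (U ∪ V) ≤ fᵢ E d V
    fᵢ-∪-bounded U V with nonempty? ((U ∪ V) ∩ E)
    ... | no _ = inj₁ z≤n
    ... | yes meets with meets-∪ U V meets
    ...   | inj₁ meetsU = inj₁ (≤-reflexive (sym (fᵢ-meets meetsU)))
    ...   | inj₂ meetsV = inj₂ (≤-reflexive (sym (fᵢ-meets meetsV)))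

    fᵢ-polymatroid : IsPolymatroidRank (fᵢ E d)
    fᵢ-polymatroid = submodular-if-∪-bounded (fᵢ E d) fᵢ-monotone fᵢ-∪-bounded , fᵢ-monotone , fᵢ-normalized

    demand-≤-rank : Nonempty E → d ≤ fᵢ E d ⊤
    demand-≤-rank (e , e∈E) = ≤-reflexive (sym (fᵢ-meets (e , x∈p∩q⁺ (∈⊤ , e∈E))))

  Σℕ-mono : ∀ {m} {g h : Fin m → ℕ} → (∀ e → g e ≤ h e) → Σℕ g ≤ Σℕ h
  Σℕ-mono {zero}  g≤h = z≤n
  Σℕ-mono {suc m} g≤h = +-mono-≤ (g≤h zero) (Σℕ-mono (g≤h ∘ suc))

  Σℕ-zero : ∀ {m} {g : Fin m → ℕ} → (∀ e → g e ≡ 0) → Σℕ g ≡ 0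
  Σℕ-zero {zero}  g≡0 = refl
  Σℕ-zero {suc m} g≡0 rewrite g≡0 zero = Σℕ-zero (g≡0 ∘ suc)

  term≤Σℕ : ∀ {m} (g : Fin m → ℕ) e → g e ≤ Σℕ g
  term≤Σℕ g zero    = m≤m+n (g zero) _
  term≤Σℕ g (suc e) = ≤-trans (term≤Σℕ (g ∘ suc) e) (m≤n+m _ (g zero))

  restrict : ∀ {m} → Subset m → (Fin m → ℕ) → Fin m → ℕ
  restrict U x e = if does (e ∈? U) then x e else 0

  ΣOver-≤-Σℕ : ∀ {m} (U : Subset m) x → ΣOver U x ≤ Σℕ x
  ΣOver-≤-Σℕ U x = Σℕ-mono restrict-≤
    where
    restrict-≤ : ∀ e → restrict U x e ≤ x e
    restrict-≤ e with e ∈? U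
    ... | yes _ = ≤-refl
    ... | no _  = z≤n

  ΣOver-vanishing : ∀ {m} (U : Subset m) x → (∀ e → e ∈ U → x e ≡ 0) → ΣOver U x ≡ 0
  ΣOver-vanishing U x vanish = Σℕ-zero restrict≡0
    where
    restrict≡0 : ∀ e → restrict U x e ≡ 0
    restrict≡0 e with e ∈? U
    ... | yes e∈U = vanish e e∈U
    ... | no _    = refl

  ≤-ΣOver-singleton : ∀ {m} x (e : Fin m) → x e ≤ ΣOver ⁅ e ⁆ x
  ≤-ΣOver-singleton x e = subst (_≤ ΣOver ⁅ e ⁆ x) restrict-e (term≤Σℕ (restrict ⁅ e ⁆ x) e)
    where
    restrict-e : restrict ⁅ e ⁆ x e ≡ x e
    restrict-e with e ∈? ⁅ e ⁆
    ... | yes _   = refl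
    ... | no e∉e  = contradiction (x∈⁅x⁆ e) e∉e

  singleton⇔base : ∀ {m} (E : Subset m) d x → SingletonStrategy E d x ⇔ InB (fᵢ E d) d x
  singleton⇔base E d x = mk⇔ to from
    where
    to : SingletonStrategy E d x → InB (fᵢ E d) d x
    to (zero-outside , total) = load-bounded , total
      where
      load-bounded : ∀ U → ΣOver U x ≤ fᵢ E d U
      load-bounded U with nonempty? (U ∩ E)
      ... | yes _     = subst (ΣOver U x ≤_) total (ΣOver-≤-Σℕ U x)
      ... | no misses = ≤-reflexive (ΣOver-vanishing U x λ e e∈U →
                          zero-outside e λ e∈E → misses (e , x∈p∩q⁺ (e∈U , e∈E)))

    from : InB (fᵢ E d) d x → SingletonStrategy E d x
    from (load-bounded , total) = zero-outside , total
      where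
      zero-outside : ∀ e → e ∉ E → x e ≡ 0
      zero-outside e e∉E = n≤0⇒n≡0 (begin
        x e               ≤⟨ ≤-ΣOver-singleton x e ⟩
        ΣOver ⁅ e ⁆ x     ≤⟨ load-bounded ⁅ e ⁆ ⟩
        fᵢ E d ⁅ e ⁆      ≡⟨ fᵢ-misses E d singleton-misses ⟩
        0                 ∎)
        where
        open ≤-Reasoning
        singleton-misses : ¬ Meets ⁅ e ⁆ E
        singleton-misses (e′ , e′∈⁅e⁆∩E) with x∈p∩q⁻ ⁅ e ⁆ E e′∈⁅e⁆∩E
        ... | e′∈⁅e⁆ , e′∈E = e∉E (subst (_∈ E) (x∈⁅y⁆⇒x≡y e e′∈⁅e⁆) e′∈E)

open SingletonRank

module OrderedCommRingProperties {c ℓ₁ ℓ₂} (R : OrderedCommRing c ℓ₁ ℓ₂) where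
  open OrderedCommRing R renaming (_≤_ to _≤ᴿ_)
  import Data.Nat as ℕ
  open import Data.Nat.Properties using (+-suc)
  open import Algebra.Properties.Ring ring
    using (-‿involutive; -1*x≈-x; //-rightDividesˡ; x[y-z]≈xy-xz; [y-z]x≈yx-zx)

  totalOrder : TotalOrder c ℓ₁ ℓ₂
  totalOrder = record { isTotalOrder = isTotalOrder }

  open TotalOrder totalOrder using (total; poset) renaming (refl to ≤-refl)
  open import Relation.Binary.Reasoning.PartialOrder poset

  +-monoʳ-≤ᴿ : ∀ z {x y} → x ≤ᴿ y → z + x ≤ᴿ z + y
  +-monoʳ-≤ᴿ z {x} {y} x≤y = begin
    z + x ≈⟨ +-comm z x ⟩
    x + z ≤⟨ +-monoˡ-≤ z x≤y ⟩
    y + z ≈⟨ +-comm y z ⟩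
    z + y ∎

  +-mono-≤ᴿ : ∀ {x y u v} → x ≤ᴿ y → u ≤ᴿ v → x + u ≤ᴿ y + v
  +-mono-≤ᴿ {x} {y} {u} {v} x≤y u≤v = begin
    x + u ≤⟨ +-monoˡ-≤ u x≤y ⟩
    y + u ≤⟨ +-monoʳ-≤ᴿ y u≤v ⟩
    y + v ∎

  x≤y⇒0≤y-x : ∀ {x y} → x ≤ᴿ y → 0# ≤ᴿ y - x
  x≤y⇒0≤y-x {x} {y} x≤y = begin
    0#     ≈⟨ sym (-‿inverseʳ x) ⟩
    x - x  ≤⟨ +-monoˡ-≤ (- x) x≤y ⟩
    y - x  ∎

  0≤y-x⇒x≤y : ∀ {x y} → 0# ≤ᴿ y - x → x ≤ᴿ y
  0≤y-x⇒x≤y {x} {y} 0≤y-x = begin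
    x             ≈⟨ sym (+-identityˡ x) ⟩
    0# + x        ≤⟨ +-monoˡ-≤ x 0≤y-x ⟩
    (y - x) + x   ≈⟨ //-rightDividesˡ x y ⟩
    y             ∎

  x≤y+x : ∀ {x y} → 0# ≤ᴿ y → x ≤ᴿ y + x
  x≤y+x {x} {y} 0≤y = begin
    x       ≈⟨ sym (+-identityˡ x) ⟩
    0# + x  ≤⟨ +-monoˡ-≤ x 0≤y ⟩
    y + x   ∎

  *-monoˡ-≤-nonneg : ∀ {z x y} → 0# ≤ᴿ z → x ≤ᴿ y → z * x ≤ᴿ z * y
  *-monoˡ-≤-nonneg {z} {x} {y} 0≤z x≤y = 0≤y-x⇒x≤y (begin
    0#              ≤⟨ *-nonneg 0≤z (x≤y⇒0≤y-x x≤y) ⟩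
    z * (y - x)     ≈⟨ x[y-z]≈xy-xz z y x ⟩
    z * y - z * x   ∎)

  -- In an ordered ring 1 is nonnegative: otherwise −1 ≥ 0 and 1 = (−1)(−1) ≥ 0.
  0≤1 : 0# ≤ᴿ 1#
  0≤1 with total 0# 1#
  ... | inj₁ 0≤1 = 0≤1
  ... | inj₂ 1≤0 = begin
    0#           ≤⟨ *-nonneg 0≤-1 0≤-1 ⟩
    - 1# * - 1#  ≈⟨ -1*x≈-x (- 1#) ⟩
    - - 1#       ≈⟨ -‿involutive 1# ⟩
    1#           ∎
    where
    0≤-1 : 0# ≤ᴿ - 1#
    0≤-1 = begin
      0#        ≈⟨ sym (-‿inverseʳ 1#) ⟩
      1# - 1#   ≤⟨ +-monoˡ-≤ (- 1#) 1≤0 ⟩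
      0# - 1#   ≈⟨ +-identityˡ (- 1#) ⟩
      - 1#      ∎

  ι-nonneg : ∀ k → 0# ≤ᴿ ι R k
  ι-nonneg zero    = ≤-refl
  ι-nonneg (suc k) = begin
    0#             ≤⟨ ι-nonneg k ⟩
    ι R k          ≤⟨ x≤y+x 0≤1 ⟩
    1# + ι R k     ∎

  Cᵢₑ-nonneg : ∀ g → NonNeg R g → NonNegC R (Cᵢₑ R g)
  Cᵢₑ-nonneg g nonneg x t = *-nonneg (nonneg (x ℕ.+ t)) (ι-nonneg x)

  Δ : (ℕ → Carrier) → ℕ → Carrier
  Δ g k = g (suc k) - g k

  Δ-nonneg : ∀ {g} → NonDecreasing R g → ∀ k → 0# ≤ᴿ Δ g k
  Δ-nonneg mono k = x≤y⇒0≤y-x (mono k)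

  marginal-identity : ∀ a b X → b * (1# + X) - a * X ≈ b + X * (b - a)
  marginal-identity a b X = begin-equality
    b * (1# + X) - a * X      ≈⟨ +-congʳ (distribˡ b 1# X) ⟩
    (b * 1# + b * X) - a * X  ≈⟨ +-congʳ (+-congʳ (*-identityʳ b)) ⟩
    (b + b * X) - a * X       ≈⟨ +-assoc b (b * X) (- (a * X)) ⟩
    b + (b * X - a * X)       ≈⟨ +-congˡ (sym ([y-z]x≈yx-zx X b a)) ⟩
    b + (b - a) * X           ≈⟨ +-congˡ (*-comm (b - a) X) ⟩
    b + X * (b - a)           ∎

  marginal-cost : ∀ g x t → C⁻ R (Cᵢₑ R g) (suc x) t ≈ g (suc (x ℕ.+ t)) + ι R x * Δ g (x ℕ.+ t)
  marginal-cost g x t = marginal-identity (g (x ℕ.+ t)) (g (suc (x ℕ.+ t))) (ι R x)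

  -- C(x;t) = c(x+t)·x is regular for nondecreasing convex c.  The case x = 0
  -- is excluded by the hypothesis 1 ≤ x of regularity.
  Cᵢₑ-regular : ∀ g → NonDecreasing R g → Convex R g → Regular R (Cᵢₑ R g)
  Cᵢₑ-regular g mono convex (suc x) t _ = more-load-costs-more , more-own-load-costs-more
    where
    s = x ℕ.+ t
    X = ι R x

    -- marginal-cost at t + 1, with (x + (t+1)) rewritten to s + 1
    shifted : C⁻ R (Cᵢₑ R g) (suc x) (suc t) ≈ g (suc (suc s)) + X * Δ g (suc s)
    shifted = subst (λ k → C⁻ R (Cᵢₑ R g) (suc x) (suc t) ≈ g (suc k) + X * Δ g k)
                    (+-suc x t) (marginal-cost g x (suc t))

    more-load-costs-more : C⁻ R (Cᵢₑ R g) (suc x) t ≤ᴿ C⁻ R (Cᵢₑ R g) (suc x) (suc t)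
    more-load-costs-more = begin
      C⁻ R (Cᵢₑ R g) (suc x) t          ≈⟨ marginal-cost g x t ⟩
      g (suc s) + X * Δ g s             ≤⟨ +-mono-≤ᴿ (mono (suc s)) (*-monoˡ-≤-nonneg (ι-nonneg x) (convex s)) ⟩
      g (suc (suc s)) + X * Δ g (suc s) ≈⟨ sym shifted ⟩
      C⁻ R (Cᵢₑ R g) (suc x) (suc t)    ∎

    more-own-load-costs-more : C⁻ R (Cᵢₑ R g) (suc x) (suc t) ≤ᴿ C⁻ R (Cᵢₑ R g) (suc (suc x)) t
    more-own-load-costs-more = begin
      C⁻ R (Cᵢₑ R g) (suc x) (suc t)                  ≈⟨ shifted ⟩
      g (suc (suc s)) + X * D                         ≤⟨ +-monoʳ-≤ᴿ _ (x≤y+x (Δ-nonneg mono (suc s))) ⟩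
      g (suc (suc s)) + (D + X * D)                   ≈⟨ +-congˡ (sym (+-congʳ (*-identityˡ D))) ⟩
      g (suc (suc s)) + (1# * D + X * D)              ≈⟨ +-congˡ (sym (distribʳ D 1# X)) ⟩
      g (suc (suc s)) + (1# + X) * D                  ≈⟨ sym (marginal-cost g (suc x) t) ⟩
      C⁻ R (Cᵢₑ R g) (suc (suc x)) t                  ∎
      where D = Δ g (suc s)

proposition4p1 : ∀ {c ℓ₁ ℓ₂} (R : OrderedCommRing c ℓ₁ ℓ₂) (n m : ℕ)
    (d : Fin n → ℕ) (Eₚ : Fin n → Subset m) → (∀ i → Nonempty (Eₚ i))
    → (cst : Fin m → ℕ → OrderedCommRing.Carrier R)
    → (∀ e → NonNeg R (cst e)) → (∀ e → NonDecreasing R (cst e)) → (∀ e → Convex R (cst e))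
    → (∀ i → IsPolymatroidRank (fᵢ (Eₚ i) (d i)) × d i ≤ fᵢ (Eₚ i) (d i) ⊤)
      × (∀ i (xᵢ : Fin m → ℕ) → SingletonStrategy (Eₚ i) (d i) xᵢ ⇔ InB (fᵢ (Eₚ i) (d i)) (d i) xᵢ)
      × (∀ (i : Fin n) (e : Fin m) → NonNegC R (Cᵢₑ R (cst e)) × Regular R (Cᵢₑ R (cst e)))
      × (∀ (x : Profile n m) (i : Fin n) → OrderedCommRing._≈_ R (π R cst x i) (ΣR R (λ e → Cᵢₑ R (cst e) (x i e) (x₋ x i e))))
proposition4p1 R n m d Eₚ nonempty cst nonneg nondecreasing convex =
  (λ i → fᵢ-polymatroid (Eₚ i) (d i) , demand-≤-rank (Eₚ i) (d i) (nonempty i)) ,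
  (λ i → singleton⇔base (Eₚ i) (d i)) ,
  (λ i e → Cᵢₑ-nonneg (cst e) (nonneg e) , Cᵢₑ-regular (cst e) (nondecreasing e) (convex e)) ,
  (λ x i → OrderedCommRing.refl R)
  where open OrderedCommRingProperties R
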